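{- Let $\mathcal{R}$ be a rewrite system on terms. In asymmetric atomic deduction modulo $\mathcal{R}$, a sequent $\Gamma \vdash \Delta$ has a proof not using the Cut rule if and only if there are a proposition $A$ in $\Gamma$ and a proposition $B$ in $\Delta$ that have a common reduct, i.e. there is a proposition $D$ with $A \rightarrow^{*} D$ and $B \rightarrow^{*} D$.
   Context: Fix a first-order language. A rewrite rule is a pair of terms $\langle l, r\rangle$, written $l \rightarrow r$, where $l$ is not a variable; a rewrite system is a set of rewrite rules. The relation $\rightarrow^{1}$ is the smallest relation on terms and on propositions that is compatible with the structure of terms and propositions and such that $\theta l \rightarrow^{1} \theta r$ for every substitution $\theta$ and every rule $l \rightarrow r$. $\rightarrow^{*}$ is its reflexive-transitive closure and $\leftarrow^{*}$ the converse of $\rightarrow^{*}$. Sequents $\Gamma \vdash \Delta$ have finite multisets $\Gamma,\Delta$ of propositions. Asymmetric atomic deduction modulo $\mathcal{R}$ is the proof system in which all propositions are atomic and whose only rules are: Axiom: $\Gamma, A_1 \vdash A_2, \Delta$ with no premise, provided there is $A$ with $A_1 \rightarrow^{*} A \leftarrow^{*} A_2$; Cut: from $\Gamma \vdash C_1, \Delta$ and $\Gamma, C_2 \vdash \Delta$ infer $\Gamma \vdash \Delta$, provided there is $C$ with $C_1 \leftarrow^{*} C \rightarrow^{*} C_2$; contraction-left: from $\Gamma, A_1, A_2 \vdash \Delta$ infer $\Gamma, A \vdash \Delta$ provided $A_1 \leftarrow^{*} A \rightarrow^{*} A_2$; contraction-right: from $\Gamma \vdash A_1, A_2, \Delta$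 infer $\Gamma \vdash A, \Delta$ provided $A_1 \leftarrow^{*} A \rightarrow^{*} A_2$; weakening-left: from $\Gamma \vdash \Delta$ infer $\Gamma, A \vdash \Delta$; weakening-right: from $\Gamma \vdash \Delta$ infer $\Gamma \vdash A, \Delta$. -}

module Defs where

open import Level using (Level)
open import Data.Nat using (ℕ)
open import Data.Vec using (Vec; []; _∷_)
open import Data.List using (List; _∷_)
open import Data.List.Relation.Binary.Permutation.Propositional using (_↭_)
open import Relation.Binary.Construct.Closure.ReflexiveTransitive using (Star)
open import Relation.Binary.PropositionalEquality using (_≡_)
open import Data.Product using (∃)
open import Data.Unit using (⊤)
open import Data.Empty using (⊥)

record Language : Set₁ where
  field
    FunSym    : Set
    funArity  : FunSym → ℕ
    PredSym   : Set
    predArity : PredSym → ℕ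

open Language

data Term (L : Language) : Set where
  var : ℕ → Term L
  app : (f : FunSym L) → Vec (Term L) (funArity L f) → Term L

-- In asymmetric atomic deduction all propositions are atomic.
data Prop (L : Language) : Set where
  atom : (P : PredSym L) → Vec (Term L) (predArity L P) → Prop L

Subst : Language → Set
Subst L = ℕ → Term L

mutual
  sub : ∀ {L} → Subst L → Term L → Term L
  sub θ (var x)    = θ x
  sub θ (app f ts) = app f (subs θ ts)

  subs : ∀ {L n} → Subst L → Vec (Term L) n → Vec (Term L) n
  subs θ []       = []
  subs θ (t ∷ ts) = sub θ t ∷ subs θ ts

IsVar : ∀ {L} → Term L → Set
IsVar t = ∃ λ x → t ≡ var x

-- A rewrite system is a set of rules l → r (given by its membership predicate).
RewriteSystem : Language → Set₁
RewriteSystem L = Term L → Term L → Set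

WellFormedRS : ∀ {L} → RewriteSystem L → Set
WellFormedRS {L} R = ∀ {l r : Term L} → R l r → IsVar l → ⊥

module _ {L : Language} (R : RewriteSystem L) where

  mutual
    data Step : Term L → Term L → Set where
      root : ∀ {l r} (θ : Subst L) → R l r → Step (sub θ l) (sub θ r)
      ctx  : ∀ f {ts us : Vec (Term L) (funArity L f)} → StepV ts us → Step (app f ts) (app f us)

    data StepV : ∀ {n} → Vec (Term L) n → Vec (Term L) n → Set where
      here  : ∀ {n t u} {ts : Vec (Term L) n} → Step t u → StepV (t ∷ ts) (u ∷ ts)
      there : ∀ {n t} {ts us : Vec (Term L) n} → StepV ts us → StepV (t ∷ ts) (t ∷ us)

  data StepP : Prop L → Prop L → Set where
    atomStep : ∀ P {ts us : Vec (Term L) (predArity L P)} → StepV ts us → StepP (atom P ts) (atom P us)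

  _⟶*_ : Prop L → Prop L → Set
  _⟶*_ = Star StepP

  infix 4 _⟶*_ _⊢_

  -- Asymmetric atomic deduction modulo R.  Sequents are lists read as
  -- multisets: "Γ, A" is any list that is a permutation of A ∷ Γ.
  data _⊢_ : List (Prop L) → List (Prop L) → Set where
    axiom : ∀ {Γ Δ Γ' Δ' A₁ A₂ A} → Γ ↭ A₁ ∷ Γ' → Δ ↭ A₂ ∷ Δ' →
            A₁ ⟶* A → A₂ ⟶* A → Γ ⊢ Δ
    cut   : ∀ {Γ Δ C C₁ C₂} → C ⟶* C₁ → C ⟶* C₂ →
            Γ ⊢ C₁ ∷ Δ → C₂ ∷ Γ ⊢ Δ → Γ ⊢ Δ
    contrL : ∀ {Γ Γ' Δ A A₁ A₂} → Γ ↭ A ∷ Γ' → A ⟶* A₁ → A ⟶* A₂ →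
             A₁ ∷ A₂ ∷ Γ' ⊢ Δ → Γ ⊢ Δ
    contrR : ∀ {Γ Δ Δ' A A₁ A₂} → Δ ↭ A ∷ Δ' → A ⟶* A₁ → A ⟶* A₂ →
             Γ ⊢ A₁ ∷ A₂ ∷ Δ' → Γ ⊢ Δ
    weakL : ∀ {Γ Γ' Δ A} → Γ ↭ A ∷ Γ' → Γ' ⊢ Δ → Γ ⊢ Δ
    weakR : ∀ {Γ Δ Δ' A} → Δ ↭ A ∷ Δ' → Γ ⊢ Δ' → Γ ⊢ Δ

  data CutFree : ∀ {Γ Δ} → Γ ⊢ Δ → Set where
    axiom : ∀ {Γ Δ Γ' Δ' A₁ A₂ A} (p : Γ ↭ A₁ ∷ Γ') (q : Δ ↭ A₂ ∷ Δ')
            (r : A₁ ⟶* A) (s : A₂ ⟶* A) → CutFree (axiom p q r s)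
    contrL : ∀ {Γ Γ' Δ A A₁ A₂} (p : Γ ↭ A ∷ Γ') (r : A ⟶* A₁) (s : A ⟶* A₂)
             {π : A₁ ∷ A₂ ∷ Γ' ⊢ Δ} → CutFree π → CutFree (contrL p r s π)
    contrR : ∀ {Γ Δ Δ' A A₁ A₂} (p : Δ ↭ A ∷ Δ') (r : A ⟶* A₁) (s : A ⟶* A₂)
             {π : Γ ⊢ A₁ ∷ A₂ ∷ Δ'} → CutFree π → CutFree (contrR p r s π)
    weakL : ∀ {Γ Γ' Δ A} (p : Γ ↭ A ∷ Γ') {π : Γ' ⊢ Δ} → CutFree π → CutFree (weakL p π)
    weakR : ∀ {Γ Δ Δ' A} (p : Δ ↭ A ∷ Δ') {π : Γ ⊢ Δ'} → CutFree π → CutFree (weakR p π)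

module Submission where

open import Defs
open import Data.List using (List; _∷_; _++_)
open import Data.List.Membership.Propositional using (_∈_; find)
open import Data.List.Membership.Propositional.Properties using (∈-∃++)
open import Data.List.Relation.Unary.Any as Any using (Any; here; there)
open import Data.List.Relation.Binary.Permutation.Propositional using (_↭_; ↭-sym)
open import Data.List.Relation.Binary.Permutation.Propositional.Properties using (Any-resp-↭; shift)
open import Data.Product using (Σ; ∃; _×_; _,_)
open import Function using (_∘′_)
open import Function.Bundles using (_⇔_; mk⇔)
open import Relation.Binary.PropositionalEquality using (refl)
open import Relation.Binary.Construct.Closure.ReflexiveTransitive using (_◅◅_)

-- A cut-free proof is built from a single axiom by weakenings and contractions.
-- Reading such a proof upwards, the invariant "some A ∈ Γ and some B ∈ Δ have a
-- common reduct" is carried from the axiom to the conclusion: weakening only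
-- enlarges Γ or Δ, and contraction replaces A₁, A₂ by some A reducing to both.
-- Conversely, a joinable pair A ∈ Γ, B ∈ Δ is itself an instance of the axiom.

module _ {A : Set} where

  ∈⇒↭-∷ : ∀ {x : A} {xs} → x ∈ xs → ∃ λ ys → xs ↭ x ∷ ys
  ∈⇒↭-∷ x∈xs with ys , zs , refl ← ∈-∃++ x∈xs = ys ++ zs , shift _ ys zs

  module _ {p} {P : A → Set p} where

    Any-here-↭ : ∀ {a xs ys} → ys ↭ a ∷ xs → P a → Any P ys
    Any-here-↭ ys↭ = Any-resp-↭ (↭-sym ys↭) ∘′ here

    Any-there-↭ : ∀ {a xs ys} → ys ↭ a ∷ xs → Any P xs → Any P ys
    Any-there-↭ ys↭ = Any-resp-↭ (↭-sym ys↭) ∘′ there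

    Any-contract : ∀ {r} {_⇝_ : A → A → Set r} →
                   (∀ {x y} → x ⇝ y → P y → P x) →
                   ∀ {a a₁ a₂ xs ys} → ys ↭ a ∷ xs → a ⇝ a₁ → a ⇝ a₂ →
                   Any P (a₁ ∷ a₂ ∷ xs) → Any P ys
    Any-contract expand ys↭ r s = Any-resp-↭ (↭-sym ys↭) ∘′ merge
      where
      merge : Any P (_ ∷ _ ∷ _) → Any P (_ ∷ _)
      merge (here p₁)         = here (expand r p₁)
      merge (there (here p₂)) = here (expand s p₂)
      merge (there (there q)) = there q

module _ {L : Language} (R : RewriteSystem L) where

  Joinable : Prop L → Prop L → Set
  Joinable A B = ∃ λ D → _⟶*_ R A D × _⟶*_ R B D

  Joinable-expandˡ : ∀ {A A′ B} → _⟶*_ R A A′ → Joinable A′ B → Joinable A B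
  Joinable-expandˡ r (D , a , b) = D , r ◅◅ a , b

  Joinable-expandʳ : ∀ {A B B′} → _⟶*_ R B B′ → Joinable A B′ → Joinable A B
  Joinable-expandʳ r (D , a , b) = D , a , r ◅◅ b

  JoinablePair : List (Prop L) → List (Prop L) → Set
  JoinablePair Γ Δ = Any (λ A → Any (Joinable A) Δ) Γ

  cutFree⇒joinablePair : ∀ {Γ Δ} {π : _⊢_ R Γ Δ} → CutFree R π → JoinablePair Γ Δ
  cutFree⇒joinablePair (axiom p q r s) =
    Any-here-↭ p (Any-here-↭ q (_ , r , s))
  cutFree⇒joinablePair (contrL p r s c) =
    Any-contract (λ r′ → Any.map (Joinable-expandˡ r′)) p r s (cutFree⇒joinablePair c)
  cutFree⇒joinablePair (contrR p r s c) =
    Any.map (Any-contract Joinable-expandʳ p r s) (cutFree⇒joinablePair c)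
  cutFree⇒joinablePair (weakL p c) = Any-there-↭ p (cutFree⇒joinablePair c)
  cutFree⇒joinablePair (weakR p c) = Any.map (Any-there-↭ p) (cutFree⇒joinablePair c)

  joinable⇒cutFree : ∀ {Γ Δ A B} → A ∈ Γ → B ∈ Δ → Joinable A B → Σ (_⊢_ R Γ Δ) (CutFree R)
  joinable⇒cutFree A∈Γ B∈Δ (_ , r , s)
    with _ , p ← ∈⇒↭-∷ A∈Γ | _ , q ← ∈⇒↭-∷ B∈Δ = _ , axiom p q r s

proposition4 : {L : Language} (R : RewriteSystem L) → WellFormedRS R →
               (Γ Δ : List (Prop L)) →
               (Σ (_⊢_ R Γ Δ) (CutFree R))
                 ⇔ (∃ λ A → ∃ λ B → A ∈ Γ × B ∈ Δ × ∃ λ D → _⟶*_ R A D × _⟶*_ R B D)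
proposition4 R _ Γ Δ = mk⇔ sound complete
  where
  Witness : Set
  Witness = ∃ λ A → ∃ λ B → A ∈ Γ × B ∈ Δ × Joinable R A B

  sound : Σ (_⊢_ R Γ Δ) (CutFree R) → Witness
  sound (_ , c) =
    let A , A∈Γ , B∈Δ-joinable = find (cutFree⇒joinablePair R c)
        B , B∈Δ , j            = find B∈Δ-joinable
    in A , B , A∈Γ , B∈Δ , j

  complete : Witness → Σ (_⊢_ R Γ Δ) (CutFree R)
  complete (_ , _ , A∈Γ , B∈Δ , j) = joinable⇒cutFree R A∈Γ B∈Δ j
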